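{- Let $n>1$ be an integer every prime divisor of which is at least $7$, and $A=U(n)^2$. Let $S:(x_1,\ldots,x_\ell)$ be an $A$-extremal sequence in $\mathbb{Z}_n$, let $k+1=(\ell+1)/3$, and let $p$ be a prime divisor of $n$ which divides every term of $S$ other than $x_{k+1}$ and $x_{2(k+1)}$ and divides neither of these two terms. Then $p$ is the unique prime divisor of $n$ that is coprime to exactly two terms of $S$, and every other prime divisor $q$ of $n$ is coprime to at least three terms of $S$.
   Context: $\mathbb{Z}_n=\mathbb{Z}/n\mathbb{Z}$, $U(n)$ its group of units, $U(n)^2=\{x^2:x\in U(n)\}$. A sequence $(x_1,\ldots,x_k)$ ($k\ge1$) in $\mathbb{Z}_n$ is an $A$-weighted zero-sum sequence if there exist $a_1,\ldots,a_k\in A$ with $a_1x_1+\cdots+a_kx_k=0$. A subsequence of consecutive terms is a nonempty block $(x_i,\ldots,x_j)$. $C_A(n)$ is the least positive integer $k$ such that every sequence of length $k$ in $\mathbb{Z}_n$ has an $A$-weighted zero-sum subsequence of consecutive terms. A sequence in $\mathbb{Z}_n$ is $A$-extremal if it has length $C_A(n)-1$ and has no $A$-weighted zero-sum subsequence of consecutive terms. A prime $q\mid n$ divides (resp. is coprime to) $x\in\mathbb{Z}_n$ if $q$ divides (resp. does not divide) the integer representatives of $x$. -}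

module Defs where

open import Data.Nat using (ℕ; zero; suc; _+_; _*_; _≤_; _<_; NonZero)
open import Data.Nat.DivMod using (_%_)
open import Data.Nat.Divisibility using (_∣_; _∣?_)
open import Data.Nat.Coprimality using (Coprime)
open import Data.Fin using (Fin; toℕ)
open import Data.List using (List; []; _∷_; _++_; length; zipWith; filter)
open import Data.Nat.ListAction using (sum)
open import Data.List.Relation.Unary.All using (All)
open import Data.Product using (Σ; ∃; _×_; _,_)
open import Relation.Nullary using (¬_; ¬?)
open import Relation.Binary.PropositionalEquality using (_≡_; _≢_)

InA : (n : ℕ) → .{{NonZero n}} → Fin n → Set
InA n a = Σ ℕ λ u → Coprime u n × toℕ a ≡ (u * u) % n

WZS : (n : ℕ) → .{{NonZero n}} → List (Fin n) → Set
WZS n ys = Σ (List (Fin n)) λ ws →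
  length ws ≡ length ys × All (InA n) ws ×
  n ∣ sum (zipWith (λ a x → toℕ a * toℕ x) ws ys)

HasZSBlock : (n : ℕ) → .{{NonZero n}} → List (Fin n) → Set
HasZSBlock n s = Σ (List (Fin n)) λ xs → Σ (List (Fin n)) λ ys → Σ (List (Fin n)) λ zs →
  s ≡ xs ++ ys ++ zs × 1 ≤ length ys × WZS n ys

AllLengthHave : (n : ℕ) → .{{NonZero n}} → ℕ → Set
AllLengthHave n k = (s : List (Fin n)) → length s ≡ k → HasZSBlock n s

IsCA : (n : ℕ) → .{{NonZero n}} → ℕ → Set
IsCA n c = 1 ≤ c × AllLengthHave n c × (∀ k → 1 ≤ k → k < c → ¬ AllLengthHave n k)

Extremal : (n : ℕ) → .{{NonZero n}} → List (Fin n) → Set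
Extremal n s = IsCA n (suc (length s)) × ¬ HasZSBlock n s

coprimeCount : {n : ℕ} → ℕ → List (Fin n) → ℕ
coprimeCount q s = length (filter (λ x → ¬? (q ∣? toℕ x)) s)

{-# OPTIONS --safe #-}
-- Split s as T₁ x T₂ y T₃ with |Tᵢ| = k; p divides every Tᵢ and neither x nor y, so it is coprime to
-- exactly two terms. Let q ≠ p be another prime divisor of n (only oddness of the prime divisors is
-- used) and suppose q divides every term of some Tᵢ. Pick h with −h a non-square mod q, so that
-- u² + h v² ≢ 0 (mod q) for v ≢ 0. Then V = Tᵢ p Tᵢ (p h) Tᵢ still has no A-weighted zero-sum block:
-- modulo q, a block through exactly one new term reduces to u² p or u² p h, and a block through
-- both to p (u² + h v²), all nonzero. All terms of V are divisible by p, so the same construction with p yields a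
-- zero-sum-free sequence of length 9k + 8 ≥ 3(k + 1) = C_A(n), a contradiction. Hence q is coprime
-- to a term of each Tᵢ, i.e. to at least three terms of s.
module Submission where

open import Defs
open import Data.Nat
open import Data.Nat.Properties
open import Data.Nat.DivMod using (_%_; _/_; m≡m%n+[m/n]*n; m%n<n)
open import Data.Nat.Divisibility
open import Data.Nat.Primality using (Prime; euclidsLemma; prime⇒irreducible; prime⇒nonZero; prime⇒nonTrivial)
open import Data.Nat.Coprimality using (Coprime; coprime-Bézout)
open import Data.Nat.GCD using (module Bézout)
open import Data.Nat.ListAction using (sum)
open import Data.Nat.Tactic.RingSolver using (solve-∀; solve)
open import Data.Fin using (Fin; toℕ; fromℕ<)
import Data.Fin as Fin
open import Data.Fin.Properties using (any?; pigeonhole; toℕ-fromℕ<; toℕ<n)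
open import Data.List using (List; []; _∷_; _++_; length; lookup; zipWith; filter; take; drop)
open import Data.List.Properties
  using (++-assoc; ++-identityʳ; ∷-injective; length-++; length-take; take++drop≡id; tabulate-lookup;
         filter-++; filter-none; filter-accept; filter-some)
open import Data.List.Relation.Unary.All as All using (All)
open import Data.List.Relation.Unary.All.Properties using (++⁺; ++⁻ˡ; ++⁻ʳ; tabulate⁺; ¬All⇒Any¬)
open import Data.Product using (Σ-syntax; ∃-syntax; ∃₂; _×_; _,_; proj₁; proj₂)
open import Data.Sum using (_⊎_; inj₁; inj₂)
open import Data.Empty using (⊥; ⊥-elim)
open import Function using (_∘_)
open import Relation.Nullary using (¬_; Dec; yes; no; ¬?; contradiction)
open import Relation.Nullary.Decidable using (decidable-stable)
open import Relation.Binary.PropositionalEquality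

∣m+n∣n⇒∣m : ∀ {d} m n → d ∣ m + n → d ∣ n → d ∣ m
∣m+n∣n⇒∣m {d} m n d∣m+n d∣n = ∣m+n∣m⇒∣n (subst (d ∣_) (+-comm m n) d∣m+n) d∣n

private
  ∣m+n∧∣m+o⇒n≡o-≤ : ∀ {r} m n o → r ∣ m + n → r ∣ m + o → o < r → n ≤ o → n ≡ o
  ∣m+n∧∣m+o⇒n≡o-≤ {r} m n o r∣m+n r∣m+o o<r n≤o with m≤n⇒∃[o]m+o≡n n≤o
  ... | zero , refl = sym (+-identityʳ n)
  ... | suc d , refl = contradiction r∣1+d (>⇒∤ (≤-<-trans (m≤n+m (suc d) n) o<r))
    where
    r∣1+d : r ∣ suc d
    r∣1+d = ∣m+n∣m⇒∣n (subst (r ∣_) (sym (+-assoc m n (suc d))) r∣m+o) r∣m+n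

∣m+n∧∣m+o⇒n≡o : ∀ {r} m n o → r ∣ m + n → r ∣ m + o → n < r → o < r → n ≡ o
∣m+n∧∣m+o⇒n≡o m n o r∣m+n r∣m+o n<r o<r with ≤-total n o
... | inj₁ n≤o = ∣m+n∧∣m+o⇒n≡o-≤ m n o r∣m+n r∣m+o o<r n≤o
... | inj₂ o≤n = sym (∣m+n∧∣m+o⇒n≡o-≤ m o n r∣m+o r∣m+n n<r o≤n)

prime⇒1<p : ∀ {p} → Prime p → 1 < p
prime⇒1<p {p} p-prime = nonTrivial⇒n>1 p {{prime⇒nonTrivial p-prime}}

prime⇒∤1 : ∀ {p} → Prime p → ¬ p ∣ 1
prime⇒∤1 p-prime p∣1 = <-irrefl (sym (∣1⇒≡1 p∣1)) (prime⇒1<p p-prime)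

prime∣square⇒∣ : ∀ {p} u → Prime p → p ∣ u * u → p ∣ u
prime∣square⇒∣ u p-prime p∣u² with euclidsLemma u u p-prime p∣u²
... | inj₁ p∣u = p∣u
... | inj₂ p∣u = p∣u

∤⇒coprime : ∀ {p v} → Prime p → ¬ p ∣ v → Coprime v p
∤⇒coprime p-prime p∤v (i∣v , i∣p) with prime⇒irreducible p-prime i∣p
... | inj₁ i≡1 = i≡1
... | inj₂ refl = contradiction i∣v p∤v

distinct-primes⇒∤ : ∀ {p q} → Prime p → Prime q → q ≢ p → ¬ q ∣ p
distinct-primes⇒∤ p-prime q-prime q≢p q∣p with prime⇒irreducible p-prime q∣p
... | inj₁ refl = <-irrefl refl (prime⇒1<p q-prime)
... | inj₂ q≡p = q≢p q≡p

distinct-primes⇒*∣ : ∀ {p q n} → Prime p → Prime q → q ≢ p → p ∣ n → q ∣ n → p * q ∣ n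
distinct-primes⇒*∣ {p} {q} p-prime q-prime q≢p (divides a refl) q∣ap with euclidsLemma a p q-prime q∣ap
... | inj₁ (divides b refl) = divides b (trans (*-assoc b q p) (cong (b *_) (*-comm q p)))
... | inj₂ q∣p = contradiction q∣p (distinct-primes⇒∤ p-prime q-prime q≢p)

-- (x v)² ≡ 1 modulo r, in subtraction-free form
∃-square-inverse : ∀ {r v} → Coprime v r → ∃[ x ] ∃₂ λ c d → x * v * (x * v) + d * r ≡ 1 + c * r
∃-square-inverse {r} {v} v⊥r with coprime-Bézout v⊥r
... | Bézout.+- x y 1+yr≡xv = x , 2 * y + y * y * r , 0 , (begin
  x * v * (x * v) + 0 * r       ≡⟨ cong (λ P → P * P + 0 * r) 1+yr≡xv ⟨
  (1 + y * r) * (1 + y * r) + 0 * r ≡⟨ solve (y ∷ r ∷ []) ⟩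
  1 + (2 * y + y * y * r) * r   ∎)
  where open ≡-Reasoning
... | Bézout.-+ x y 1+xv≡yr = x , y * y * r , 2 * y , (begin
  x * v * (x * v) + 2 * y * r         ≡⟨ solve (x ∷ v ∷ y ∷ r ∷ []) ⟩
  x * v * (x * v) + 2 * (y * r)       ≡⟨ cong (λ z → x * v * (x * v) + 2 * z) 1+xv≡yr ⟨
  x * v * (x * v) + 2 * (1 + x * v)   ≡⟨ solve (x ∷ v ∷ []) ⟩
  1 + (1 + x * v) * (1 + x * v)       ≡⟨ cong (λ z → 1 + z * z) 1+xv≡yr ⟩
  1 + y * r * (y * r)                 ≡⟨ solve (y ∷ r ∷ []) ⟩
  1 + y * y * r * r                   ∎)
  where open ≡-Reasoning

IsNegSquare : ℕ → ℕ → Set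
IsNegSquare r h = Σ[ w ∈ Fin r ] r ∣ toℕ w * toℕ w + h

isNegSquare? : ∀ r h → Dec (IsNegSquare r h)
isNegSquare? r h = any? (λ w → r ∣? toℕ w * toℕ w + h)

∣square+h⇒IsNegSquare : ∀ {r h} .{{_ : NonZero r}} m → r ∣ m * m + h → IsNegSquare r h
∣square+h⇒IsNegSquare {r} {h} m r∣m²+h =
  fromℕ< (m%n<n m r) , subst (λ w → r ∣ w * w + h) (sym (toℕ-fromℕ< (m%n<n m r))) r∣[m%r]²+h
  where
  open ≡-Reasoning
  a q : ℕ
  a = m % r
  q = m / r
  m²+h≡ : m * m + h ≡ (a * a + h) + (q * (2 * a + q * r)) * r
  m²+h≡ = begin
    m * m + h                         ≡⟨ cong (λ z → z * z + h) (m≡m%n+[m/n]*n m r) ⟩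
    (a + q * r) * (a + q * r) + h     ≡⟨ expand a q r h ⟩
    (a * a + h) + (q * (2 * a + q * r)) * r ∎
    where
    expand : ∀ a q r h → (a + q * r) * (a + q * r) + h ≡ (a * a + h) + (q * (2 * a + q * r)) * r
    expand = solve-∀
  r∣[m%r]²+h : r ∣ a * a + h
  r∣[m%r]²+h = ∣m+n∣n⇒∣m _ _ (subst (r ∣_) m²+h≡ r∣m²+h) (n∣m*n (q * (2 * a + q * r)))

Anisotropic : ℕ → ℕ → Set
Anisotropic r h = ∀ u v → ¬ r ∣ v → ¬ r ∣ u * u + h * (v * v)

∣A+h*P²⇒∣A+h : ∀ {r} A h P c d → P * P + d * r ≡ 1 + c * r → r ∣ A + h * (P * P) → r ∣ A + h
∣A+h*P²⇒∣A+h {r} A h P c d P²≡1 r∣A+hP² =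
  ∣m+n∣n⇒∣m (A + h) ((h * c) * r) (subst (r ∣_) eq r∣sum) (n∣m*n (h * c))
  where
  open ≡-Reasoning
  r∣sum : r ∣ A + h * (P * P) + (h * d) * r
  r∣sum = ∣m∣n⇒∣m+n r∣A+hP² (n∣m*n (h * d))
  eq : A + h * (P * P) + (h * d) * r ≡ A + h + (h * c) * r
  eq = begin
    A + h * (P * P) + (h * d) * r ≡⟨ solve (A ∷ h ∷ P ∷ d ∷ r ∷ []) ⟩
    A + h * (P * P + d * r)       ≡⟨ cong (λ z → A + h * z) P²≡1 ⟩
    A + h * (1 + c * r)           ≡⟨ solve (A ∷ h ∷ c ∷ r ∷ []) ⟩
    A + h + (h * c) * r           ∎

¬IsNegSquare⇒Anisotropic : ∀ {r h} → Prime r → ¬ IsNegSquare r h → Anisotropic r h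
¬IsNegSquare⇒Anisotropic {r} {h} r-prime ¬neg u v r∤v r∣u²+hv² with ∃-square-inverse (∤⇒coprime r-prime r∤v)
... | x , c , d , [xv]²≡1 =
  ¬neg (∣square+h⇒IsNegSquare {{prime⇒nonZero r-prime}} (u * x)
    (∣A+h*P²⇒∣A+h (u * x * (u * x)) h (x * v) c d [xv]²≡1
      (subst (r ∣_) scaled (∣n⇒∣m*n (x * x) r∣u²+hv²))))
  where
  scaled : x * x * (u * u + h * (v * v)) ≡ u * x * (u * x) + h * (x * v * (x * v))
  scaled = solve (x ∷ u ∷ h ∷ v ∷ [])

-- a root w of w² ≡ −h with 0 < h can be taken in 1 … r − 2, since (r − 1)² ≡ 1²
IsNegSquare⇒small-root : ∀ {t h} w → w < 3 + t → 3 + t ∣ w * w + h → 0 < h → h < 3 + t →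
  Σ[ c ∈ Fin (suc t) ] 3 + t ∣ suc (toℕ c) * suc (toℕ c) + h
IsNegSquare⇒small-root zero _ r∣h 0<h h<r = contradiction r∣h (>⇒∤ {{>-nonZero 0<h}} h<r)
IsNegSquare⇒small-root {t} {h} (suc m) w<r r∣w²+h _ _ with suc m ≟ 2 + t
... | yes refl = Fin.zero ,
  ∣m+n∣n⇒∣m (1 * 1 + h) ((1 + t) * (3 + t)) (subst (3 + t ∣_) (reflect t h) r∣w²+h) (n∣m*n (1 + t))
  where
  reflect : ∀ t h → (2 + t) * (2 + t) + h ≡ (1 * 1 + h) + (1 + t) * (3 + t)
  reflect = solve-∀
... | no w≢r-1 = fromℕ< m<1+t , subst (λ c → 3 + t ∣ suc c * suc c + h) (sym (toℕ-fromℕ< m<1+t)) r∣w²+h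
  where
  m<1+t : m < suc t
  m<1+t = ≤∧≢⇒< (≤-pred (≤-pred w<r)) (λ m≡1+t → w≢r-1 (cong suc m≡1+t))

-- pigeonhole: the r − 1 values h = 1 … r − 1 cannot all be negatives of the r − 2 squares 1², …, (r − 2)²
∃-¬IsNegSquare : ∀ {r} → 3 ≤ r → ∃[ h ] h < r × ¬ IsNegSquare r h
∃-¬IsNegSquare (s≤s (s≤s (s≤s {n = t} _)))
  with any? (λ (i : Fin (2 + t)) → ¬? (isNegSquare? (3 + t) (suc (toℕ i))))
... | yes (i , ¬neg) = suc (toℕ i) , s≤s (toℕ<n i) , ¬neg
... | no ∄¬neg = ⊥-elim (all-neg⇒⊥ λ i → decidable-stable (isNegSquare? _ _) (λ ¬neg → ∄¬neg (i , ¬neg)))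
  where
  root : (∀ (i : Fin (2 + t)) → IsNegSquare (3 + t) (suc (toℕ i))) →
    ∀ i → Σ[ c ∈ Fin (suc t) ] 3 + t ∣ suc (toℕ c) * suc (toℕ c) + suc (toℕ i)
  root neg i = IsNegSquare⇒small-root (toℕ (proj₁ (neg i))) (toℕ<n _) (proj₂ (neg i)) z<s (s≤s (toℕ<n i))
  all-neg⇒⊥ : (∀ (i : Fin (2 + t)) → IsNegSquare (3 + t) (suc (toℕ i))) → ⊥
  all-neg⇒⊥ neg with pigeonhole (n<1+n (suc t)) (λ i → proj₁ (root neg i))
  ... | i , j , i<j , same-root = <-irrefl (suc-injective i≡j) i<j
    where
    c : ℕ
    c = suc (toℕ (proj₁ (root neg j)))
    i≡j : suc (toℕ i) ≡ suc (toℕ j)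
    i≡j = ∣m+n∧∣m+o⇒n≡o (c * c) _ _
      (subst (λ c → 3 + t ∣ suc (toℕ c) * suc (toℕ c) + suc (toℕ i)) same-root (proj₂ (root neg i)))
      (proj₂ (root neg j)) (s≤s (toℕ<n i)) (s≤s (toℕ<n j))

∃-Anisotropic : ∀ {r} → Prime r → 3 ≤ r → ∃[ h ] h < r × Anisotropic r h
∃-Anisotropic r-prime 3≤r with ∃-¬IsNegSquare 3≤r
... | h , h<r , ¬neg = h , h<r , ¬IsNegSquare⇒Anisotropic r-prime ¬neg

Anisotropic⇒∤ : ∀ {r h} → Prime r → Anisotropic r h → ¬ r ∣ h
Anisotropic⇒∤ {r} {h} r-prime aniso r∣h = aniso 0 1 (prime⇒∤1 r-prime) (subst (r ∣_) (sym (*-identityʳ h)) r∣h)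

module _ {a} {A : Set a} where

  _IsPrefixOf_ _IsSuffixOf_ _IsInfixOf_ : List A → List A → Set a
  ys IsPrefixOf L = Σ[ zs ∈ List A ] L ≡ ys ++ zs
  ys IsSuffixOf L = Σ[ xs ∈ List A ] L ≡ xs ++ ys
  ys IsInfixOf L = Σ[ xs ∈ List A ] Σ[ zs ∈ List A ] L ≡ xs ++ ys ++ zs

  All-prefix : ∀ {p} {P : A → Set p} {ys L} → All P L → ys IsPrefixOf L → All P ys
  All-prefix pL (_ , refl) = ++⁻ˡ _ pL

  All-suffix : ∀ {p} {P : A → Set p} {ys L} → All P L → ys IsSuffixOf L → All P ys
  All-suffix pL (xs , refl) = ++⁻ʳ xs pL

  prefix-of-++-∷ : ∀ L₁ (x : A) L₂ ys zs → L₁ ++ x ∷ L₂ ≡ ys ++ zs →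
    ys IsPrefixOf L₁ ⊎ Σ[ ys₂ ∈ List A ] ys ≡ L₁ ++ x ∷ ys₂ × ys₂ IsPrefixOf L₂
  prefix-of-++-∷ L₁ x L₂ [] zs _ = inj₁ (L₁ , refl)
  prefix-of-++-∷ [] x L₂ (y ∷ ys) zs eq with ∷-injective eq
  ... | refl , L₂≡ = inj₂ (ys , refl , zs , L₂≡)
  prefix-of-++-∷ (l ∷ L₁) x L₂ (y ∷ ys) zs eq with ∷-injective eq
  ... | refl , eq′ with prefix-of-++-∷ L₁ x L₂ ys zs eq′
  ...   | inj₁ (zs′ , L₁≡) = inj₁ (zs′ , cong (l ∷_) L₁≡)
  ...   | inj₂ (ys₂ , ys≡ , pre) = inj₂ (ys₂ , cong (l ∷_) ys≡ , pre)

  infix-of-++-∷ : ∀ L₁ (x : A) L₂ xs ys zs → L₁ ++ x ∷ L₂ ≡ xs ++ ys ++ zs →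
    ys IsInfixOf L₁ ⊎ ys IsInfixOf L₂ ⊎
    Σ[ ys₁ ∈ List A ] Σ[ ys₂ ∈ List A ] ys ≡ ys₁ ++ x ∷ ys₂ × ys₁ IsSuffixOf L₁ × ys₂ IsPrefixOf L₂
  infix-of-++-∷ L₁ x L₂ [] ys zs eq with prefix-of-++-∷ L₁ x L₂ ys zs eq
  ... | inj₁ (zs′ , L₁≡) = inj₁ ([] , zs′ , L₁≡)
  ... | inj₂ (ys₂ , ys≡ , pre) = inj₂ (inj₂ (L₁ , ys₂ , ys≡ , ([] , refl) , pre))
  infix-of-++-∷ [] x L₂ (_ ∷ xs) ys zs eq with ∷-injective eq
  ... | refl , L₂≡ = inj₂ (inj₁ (xs , zs , L₂≡))
  infix-of-++-∷ (l ∷ L₁) x L₂ (_ ∷ xs) ys zs eq with ∷-injective eq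
  ... | refl , eq′ with infix-of-++-∷ L₁ x L₂ xs ys zs eq′
  ...   | inj₁ (xs′ , zs′ , L₁≡) = inj₁ (l ∷ xs′ , zs′ , cong (l ∷_) L₁≡)
  ...   | inj₂ (inj₁ inf) = inj₂ (inj₁ inf)
  ...   | inj₂ (inj₂ (ys₁ , ys₂ , ys≡ , (xs′ , L₁≡) , pre)) =
          inj₂ (inj₂ (ys₁ , ys₂ , ys≡ , (l ∷ xs′ , cong (l ∷_) L₁≡) , pre))

  split-alongside : ∀ {b} {B : Set b} (ws : List B) ys₁ (y : A) ys₂ → length ws ≡ length (ys₁ ++ y ∷ ys₂) →
    Σ[ ws₁ ∈ List B ] Σ[ w ∈ B ] Σ[ ws₂ ∈ List B ]
      ws ≡ ws₁ ++ w ∷ ws₂ × length ws₁ ≡ length ys₁ × length ws₂ ≡ length ys₂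
  split-alongside (w ∷ ws) [] y ys₂ eq = [] , w , ws , refl , refl , suc-injective eq
  split-alongside (w ∷ ws) (_ ∷ ys₁) y ys₂ eq with split-alongside ws ys₁ y ys₂ (suc-injective eq)
  ... | ws₁ , w′ , ws₂ , refl , len₁ , len₂ = w ∷ ws₁ , w′ , ws₂ , refl , cong suc len₁ , len₂

  triple : List A → A → A → List A
  triple B x y = B ++ x ∷ (B ++ y ∷ B)

  length-triple : ∀ B x y → length (triple B x y) ≡ 3 * length B + 2
  length-triple B x y = begin
    length (B ++ x ∷ (B ++ y ∷ B))               ≡⟨ length-++ B ⟩
    length B + suc (length (B ++ y ∷ B))         ≡⟨ cong (λ m → length B + suc m) (length-++ B) ⟩
    length B + suc (length B + suc (length B))   ≡⟨ arrange (length B) ⟩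
    3 * length B + 2                             ∎
    where
    open ≡-Reasoning
    arrange : ∀ b → b + suc (b + suc b) ≡ 3 * b + 2
    arrange = solve-∀

  split-at : ∀ (s : List A) m → m ≤ length s → Σ[ xs ∈ List A ] Σ[ ys ∈ List A ] s ≡ xs ++ ys × length xs ≡ m
  split-at s zero _ = [] , s , refl , refl
  split-at (x ∷ s) (suc m) (s≤s m≤|s|) with split-at s m m≤|s|
  ... | xs , ys , refl , refl = x ∷ xs , ys , refl , refl

  private
    length-++⁻ʳ : ∀ (xs ys : List A) {k m} → length (xs ++ ys) ≡ k + m → length xs ≡ k → length ys ≡ m
    length-++⁻ʳ xs ys {k} |xs++ys| |xs| = +-cancelˡ-≡ k _ _
      (trans (cong (_+ length ys) (sym |xs|)) (trans (sym (length-++ xs)) |xs++ys|))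

  split-pivots : ∀ (s : List A) k → length s ≡ k + suc (k + suc k) →
    Σ[ T₁ ∈ List A ] Σ[ x ∈ A ] Σ[ T₂ ∈ List A ] Σ[ y ∈ A ] Σ[ T₃ ∈ List A ]
      s ≡ T₁ ++ x ∷ (T₂ ++ y ∷ T₃) × length T₁ ≡ k × length T₂ ≡ k × length T₃ ≡ k
  split-pivots s k |s| with split-at s k (subst (k ≤_) (sym |s|) (m≤m+n k _))
  ... | T₁ , R₁ , refl , |T₁| with R₁ | length-++⁻ʳ T₁ R₁ |s| |T₁|
  ... | x ∷ R₂ | |R₁| with split-at R₂ k (subst (k ≤_) (sym (suc-injective |R₁|)) (m≤m+n k _))
  ... | T₂ , R₃ , refl , |T₂| with R₃ | length-++⁻ʳ T₂ R₃ (suc-injective |R₁|) |T₂|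
  ... | y ∷ T₃ | |R₃| = T₁ , x , T₂ , y , T₃ , refl , |T₁| , |T₂| , suc-injective |R₃|

module _ {a} {A : Set a} {ℓ} (P : ℕ → A → Set ℓ) where

  Indexed : ℕ → List A → Set ℓ
  Indexed o xs = ∀ (i : Fin (length xs)) → P (o + toℕ i) (lookup xs i)

  Indexed-head : ∀ {o x xs} → Indexed o (x ∷ xs) → P (o + 0) x
  Indexed-head f = f Fin.zero

  Indexed-tail : ∀ {o x xs} → Indexed o (x ∷ xs) → Indexed (suc o) xs
  Indexed-tail {o} {xs = xs} f i = subst (λ m → P m (lookup xs i)) (+-suc o (toℕ i)) (f (Fin.suc i))

  Indexed-++ˡ : ∀ {o} xs {ys} → Indexed o (xs ++ ys) → Indexed o xs
  Indexed-++ˡ (x ∷ xs) f Fin.zero = f Fin.zero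
  Indexed-++ˡ {o} (x ∷ xs) f (Fin.suc i) =
    subst (λ m → P m (lookup xs i)) (sym (+-suc o (toℕ i))) (Indexed-++ˡ xs (Indexed-tail f) i)

  Indexed-++ʳ : ∀ {o} xs {ys} → Indexed o (xs ++ ys) → Indexed (o + length xs) ys
  Indexed-++ʳ {o} [] {ys} f = subst (λ m → Indexed m ys) (sym (+-identityʳ o)) f
  Indexed-++ʳ {o} (x ∷ xs) {ys} f =
    subst (λ m → Indexed m ys) (sym (+-suc o (length xs))) (Indexed-++ʳ xs (Indexed-tail f))

  Indexed⇒All : ∀ {q} {Q : A → Set q} {o xs} → (∀ {i x} → o ≤ i → i < o + length xs → P i x → Q x) →
    Indexed o xs → All Q xs
  Indexed⇒All {Q = Q} {o} {xs} P⇒Q f = subst (All Q) (tabulate-lookup xs)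
    (tabulate⁺ λ i → P⇒Q (m≤m+n o (toℕ i)) (+-monoʳ-< o (toℕ<n i)) (f i))

_∣ᶠ_ : ∀ {n} → ℕ → Fin n → Set
r ∣ᶠ x = r ∣ toℕ x

module _ {n : ℕ} .{{_ : NonZero n}} where

  weightedSum : List (Fin n) → List (Fin n) → ℕ
  weightedSum ws ys = sum (zipWith (λ a x → toℕ a * toℕ x) ws ys)

  weightedSum-++ : ∀ ws₁ ys₁ ws₂ ys₂ → length ws₁ ≡ length ys₁ →
    weightedSum (ws₁ ++ ws₂) (ys₁ ++ ys₂) ≡ weightedSum ws₁ ys₁ + weightedSum ws₂ ys₂
  weightedSum-++ [] [] ws₂ ys₂ _ = refl
  weightedSum-++ (a ∷ ws₁) (y ∷ ys₁) ws₂ ys₂ eq =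
    trans (cong (toℕ a * toℕ y +_) (weightedSum-++ ws₁ ys₁ ws₂ ys₂ (suc-injective eq)))
          (sym (+-assoc (toℕ a * toℕ y) (weightedSum ws₁ ys₁) (weightedSum ws₂ ys₂)))

  ∣weightedSum : ∀ {r} ws {ys} → All (r ∣ᶠ_) ys → r ∣ weightedSum ws ys
  ∣weightedSum [] _ = _ ∣0
  ∣weightedSum (w ∷ ws) All.[] = _ ∣0
  ∣weightedSum (w ∷ ws) (r∣y All.∷ r∣ys) = ∣m∣n⇒∣m+n (∣n⇒∣m*n (toℕ w) r∣y) (∣weightedSum ws r∣ys)

  InA⇒≡square : ∀ {r a} → Prime r → r ∣ n → InA n a →
    Σ[ u ∈ ℕ ] ¬ r ∣ u × Σ[ t ∈ ℕ ] toℕ a + t * r ≡ u * u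
  InA⇒≡square {r} {a} r-prime r∣n@(divides c n≡cr) (u , u⊥n , a≡u²%n) =
    u , (λ r∣u → <-irrefl (sym (u⊥n (r∣u , r∣n))) (prime⇒1<p r-prime)) , u * u / n * c , (begin
    toℕ a + u * u / n * c * r     ≡⟨ cong₂ _+_ a≡u²%n (*-assoc (u * u / n) c r) ⟩
    u * u % n + u * u / n * (c * r) ≡⟨ cong (λ m → u * u % n + u * u / n * m) n≡cr ⟨
    u * u % n + u * u / n * n     ≡⟨ m≡m%n+[m/n]*n (u * u) n ⟨
    u * u                         ∎)
    where open ≡-Reasoning

  InA⇒∤ : ∀ {r a} → Prime r → r ∣ n → InA n a → ¬ r ∣ toℕ a
  InA⇒∤ {r} {a} r-prime r∣n a∈A r∣a with InA⇒≡square r-prime r∣n a∈A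
  ... | u , r∤u , t , a+tr≡u² =
    r∤u (prime∣square⇒∣ u r-prime (subst (r ∣_) a+tr≡u² (∣m∣n⇒∣m+n r∣a (n∣m*n t))))

  private
    ∣a+b*h⇒∣u²+h*v² : ∀ {r} a b h t t′ u v → a + t * r ≡ u * u → b + t′ * r ≡ v * v →
      r ∣ a + b * h → r ∣ u * u + h * (v * v)
    ∣a+b*h⇒∣u²+h*v² {r} a b h t t′ u v a≡u² b≡v² r∣a+bh =
      subst (r ∣_) eq (∣m∣n⇒∣m+n r∣a+bh (n∣m*n (t + h * t′)))
      where
      open ≡-Reasoning
      eq : a + b * h + (t + h * t′) * r ≡ u * u + h * (v * v)
      eq = begin
        a + b * h + (t + h * t′) * r      ≡⟨ regroup a b h t t′ r ⟩
        (a + t * r) + h * (b + t′ * r)    ≡⟨ cong₂ (λ x y → x + h * y) a≡u² b≡v² ⟩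
        u * u + h * (v * v)               ∎
        where
        regroup : ∀ a b h t t′ r → a + b * h + (t + h * t′) * r ≡ (a + t * r) + h * (b + t′ * r)
        regroup = solve-∀

  ∣+weightedSum-++⁻ʳ : ∀ {r} X ws₁ ys₁ {ws ys} → length ws₁ ≡ length ys₁ → All (r ∣ᶠ_) ys₁ →
    r ∣ X + weightedSum (ws₁ ++ ws) (ys₁ ++ ys) → r ∣ X + weightedSum ws ys
  ∣+weightedSum-++⁻ʳ {r} X ws₁ ys₁ {ws} {ys} len r∣ys₁ r∣Σ =
    ∣m+n∣m⇒∣n (subst (r ∣_) split r∣Σ) (∣weightedSum ws₁ r∣ys₁)
    where
    swap : ∀ x y z → x + (y + z) ≡ y + (x + z)
    swap = solve-∀
    split : X + weightedSum (ws₁ ++ ws) (ys₁ ++ ys) ≡ weightedSum ws₁ ys₁ + (X + weightedSum ws ys)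
    split = trans (cong (X +_) (weightedSum-++ ws₁ ys₁ ws ys len)) (swap X (weightedSum ws₁ ys₁) (weightedSum ws ys))

  ¬WZS-one-indivisible : ∀ {r} → Prime r → r ∣ n → ∀ ys₁ e ys₂ →
    All (r ∣ᶠ_) ys₁ → All (r ∣ᶠ_) ys₂ → ¬ r ∣ᶠ e → ¬ WZS n (ys₁ ++ e ∷ ys₂)
  ¬WZS-one-indivisible {r} r-prime r∣n ys₁ e ys₂ r∣ys₁ r∣ys₂ r∤e (ws , len , ws∈A , n∣Σ)
    with split-alongside ws ys₁ e ys₂ len
  ... | ws₁ , a , ws₂ , refl , len₁ , _ with euclidsLemma (toℕ a) (toℕ e) r-prime r∣ae
    where
    r∣ae : r ∣ toℕ a * toℕ e
    r∣ae = ∣m+n∣n⇒∣m _ _ (∣+weightedSum-++⁻ʳ 0 ws₁ ys₁ len₁ r∣ys₁ (∣-trans r∣n n∣Σ))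
             (∣weightedSum ws₂ r∣ys₂)
  ... | inj₁ r∣a = InA⇒∤ r-prime r∣n (All.head (++⁻ʳ ws₁ ws∈A)) r∣a
  ... | inj₂ r∣e = r∤e r∣e

  -- modulo r the weighted sum is e (u² + h v²) for units u, v
  ¬WZS-anisotropic-pair : ∀ {r h} → Prime r → r ∣ n → Anisotropic r h → ∀ ys₁ e ys₂ f ys₃ →
    All (r ∣ᶠ_) ys₁ → All (r ∣ᶠ_) ys₂ → All (r ∣ᶠ_) ys₃ → ¬ r ∣ᶠ e → toℕ f ≡ toℕ e * h →
    ¬ WZS n (ys₁ ++ e ∷ (ys₂ ++ f ∷ ys₃))
  ¬WZS-anisotropic-pair {r} {h} r-prime r∣n aniso ys₁ e ys₂ f ys₃ r∣ys₁ r∣ys₂ r∣ys₃ r∤e f≡eh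
    (ws , len , ws∈A , n∣Σ)
    with split-alongside ws ys₁ e (ys₂ ++ f ∷ ys₃) len
  ... | ws₁ , a , ws₂₃ , refl , len₁ , len₂₃ with split-alongside ws₂₃ ys₂ f ys₃ len₂₃
  ... | ws₂ , b , ws₃ , refl , len₂ , _
    with euclidsLemma (toℕ e) (toℕ a + toℕ b * h) r-prime r∣e[a+bh]
    where
    r∣ae+[bf+W₃] : r ∣ toℕ a * toℕ e + (toℕ b * toℕ f + weightedSum ws₃ ys₃)
    r∣ae+[bf+W₃] = ∣+weightedSum-++⁻ʳ (toℕ a * toℕ e) ws₂ ys₂ len₂ r∣ys₂
                     (∣+weightedSum-++⁻ʳ 0 ws₁ ys₁ len₁ r∣ys₁ (∣-trans r∣n n∣Σ))
    r∣ae+bf : r ∣ toℕ a * toℕ e + toℕ b * toℕ f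
    r∣ae+bf = ∣m+n∣n⇒∣m _ _
      (subst (r ∣_) (sym (+-assoc (toℕ a * toℕ e) (toℕ b * toℕ f) (weightedSum ws₃ ys₃))) r∣ae+[bf+W₃])
      (∣weightedSum ws₃ r∣ys₃)
    factor : ∀ a e b h → a * e + b * (e * h) ≡ e * (a + b * h)
    factor = solve-∀
    r∣e[a+bh] : r ∣ toℕ e * (toℕ a + toℕ b * h)
    r∣e[a+bh] = subst (r ∣_)
      (trans (cong (λ m → toℕ a * toℕ e + toℕ b * m) f≡eh) (factor (toℕ a) (toℕ e) (toℕ b) h))
                  r∣ae+bf
  ... | inj₁ r∣e = r∤e r∣e
  ... | inj₂ r∣a+bh with InA⇒≡square r-prime r∣n (All.head (++⁻ʳ ws₁ ws∈A))
                       | InA⇒≡square r-prime r∣n (All.head (++⁻ʳ ws₂ (All.tail (++⁻ʳ ws₁ ws∈A))))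
  ... | u , _ , t , a≡u² | v , r∤v , t′ , b≡v² =
        aniso u v r∤v (∣a+b*h⇒∣u²+h*v² (toℕ a) (toℕ b) h t t′ u v a≡u² b≡v² r∣a+bh)

  HasZSBlock-infix : ∀ {L s} → L IsInfixOf s → HasZSBlock n L → HasZSBlock n s
  HasZSBlock-infix (P , C , refl) (xs , ys , zs , refl , 1≤|ys| , wzs) =
    P ++ xs , ys , zs ++ C , assoc , 1≤|ys| , wzs
    where
    open ≡-Reasoning
    assoc : P ++ (xs ++ ys ++ zs) ++ C ≡ (P ++ xs) ++ ys ++ zs ++ C
    assoc = begin
      P ++ (xs ++ ys ++ zs) ++ C   ≡⟨ cong (P ++_) (++-assoc xs (ys ++ zs) C) ⟩
      P ++ xs ++ (ys ++ zs) ++ C   ≡⟨ cong (λ l → P ++ xs ++ l) (++-assoc ys zs C) ⟩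
      P ++ xs ++ ys ++ zs ++ C     ≡⟨ ++-assoc P xs (ys ++ zs ++ C) ⟨
      (P ++ xs) ++ ys ++ zs ++ C   ∎

  AllLengthHave⇒HasZSBlock : ∀ {m} s → AllLengthHave n m → m ≤ length s → HasZSBlock n s
  AllLengthHave⇒HasZSBlock {m} s all-m m≤|s| =
    HasZSBlock-infix ([] , drop m s , sym (take++drop≡id m s))
      (all-m (take m s) (trans (length-take m s) (m≤n⇒m⊓n≡m m≤|s|)))

  ¬HasZSBlock-triple : ∀ {r h} → Prime r → r ∣ n → Anisotropic r h →
    ∀ {B} → All (r ∣ᶠ_) B → ¬ HasZSBlock n B →
    ∀ x y → ¬ r ∣ᶠ x → toℕ y ≡ toℕ x * h → ¬ HasZSBlock n (triple B x y)
  ¬HasZSBlock-triple {r} {h} r-prime r∣n aniso {B} r∣B free x y r∤x y≡xh (xs , ys , zs , eq , 1≤|ys| , wzs)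
    with infix-of-++-∷ B x (B ++ y ∷ B) xs ys zs eq
  ... | inj₁ (xs′ , zs′ , B≡) = free (xs′ , ys , zs′ , B≡ , 1≤|ys| , wzs)
  ... | inj₂ (inj₁ (xs′ , zs′ , B++y∷B≡)) with infix-of-++-∷ B y B xs′ ys zs′ B++y∷B≡
  ...   | inj₁ (xs″ , zs″ , B≡) = free (xs″ , ys , zs″ , B≡ , 1≤|ys| , wzs)
  ...   | inj₂ (inj₁ (xs″ , zs″ , B≡)) = free (xs″ , ys , zs″ , B≡ , 1≤|ys| , wzs)
  ...   | inj₂ (inj₂ (ys₁ , ys₂ , refl , suf , pre)) =
          ¬WZS-one-indivisible r-prime r∣n ys₁ y ys₂ (All-suffix r∣B suf) (All-prefix r∣B pre) r∤y wzs
    where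
    r∤y : ¬ r ∣ᶠ y
    r∤y r∣y with euclidsLemma (toℕ x) h r-prime (subst (r ∣_) y≡xh r∣y)
    ... | inj₁ r∣x = r∤x r∣x
    ... | inj₂ r∣h = Anisotropic⇒∤ r-prime aniso r∣h
  ¬HasZSBlock-triple {r} {h} r-prime r∣n aniso {B} r∣B free x y r∤x y≡xh (xs , ys , zs , eq , 1≤|ys| , wzs)
    | inj₂ (inj₂ (ys₁ , ys₂ , refl , suf , (zs′ , B++y∷B≡))) with prefix-of-++-∷ B y B ys₂ zs′ B++y∷B≡
  ... | inj₁ pre =
        ¬WZS-one-indivisible r-prime r∣n ys₁ x ys₂ (All-suffix r∣B suf) (All-prefix r∣B pre) r∤x wzs
  ... | inj₂ (ys₃ , refl , pre) =
        ¬WZS-anisotropic-pair r-prime r∣n aniso ys₁ x B y ys₃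
          (All-suffix r∣B suf) r∣B (All-prefix r∣B pre) r∤x y≡xh wzs

  -- the new terms p and p h keep V divisible by p, so V can be tripled again with respect to p
  ¬HasZSBlock-amplify : ∀ {p q h g} → Prime p → Prime q → q ≢ p → p ∣ n → q ∣ n →
    h < q → Anisotropic q h → g < p → Anisotropic p g →
    ∀ T → All (p ∣ᶠ_) T → All (q ∣ᶠ_) T → ¬ HasZSBlock n T →
    Σ[ W ∈ List (Fin n) ] length W ≡ 3 * (3 * length T + 2) + 2 × ¬ HasZSBlock n W
  ¬HasZSBlock-amplify {p} {q} {h} {g} p-prime q-prime q≢p p∣n q∣n h<q aniso-q g<p aniso-p T p∣T q∣T free =
    W , |W| , free-W
    where
    instance
      p≢0 : NonZero p
      p≢0 = prime⇒nonZero p-prime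
    pq≤n : p * q ≤ n
    pq≤n = ∣⇒≤ (distinct-primes⇒*∣ p-prime q-prime q≢p p∣n q∣n)
    p≤n : p ≤ n
    p≤n = ∣⇒≤ p∣n
    1<n : 1 < n
    1<n = <-≤-trans (prime⇒1<p p-prime) p≤n
    g<n : g < n
    g<n = <-≤-trans g<p p≤n
    p<n : p < n
    p<n = <-≤-trans (m<m*n p q (prime⇒1<p q-prime)) pq≤n
    ph<n : p * h < n
    ph<n = <-≤-trans (*-monoʳ-< p h<q) pq≤n
    x y x′ y′ : Fin n
    x = fromℕ< p<n
    y = fromℕ< ph<n
    x′ = fromℕ< 1<n
    y′ = fromℕ< g<n
    V W : List (Fin n)
    V = triple T x y
    W = triple V x′ y′
    p∣V : All (p ∣ᶠ_) V
    p∣V = ++⁺ p∣T (subst (p ∣_) (sym (toℕ-fromℕ< p<n)) ∣-refl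
               All.∷ ++⁺ p∣T (subst (p ∣_) (sym (toℕ-fromℕ< ph<n)) (m∣m*n h) All.∷ p∣T))
    free-V : ¬ HasZSBlock n V
    free-V = ¬HasZSBlock-triple q-prime q∣n aniso-q q∣T free x y
      (distinct-primes⇒∤ p-prime q-prime q≢p ∘ subst (q ∣_) (toℕ-fromℕ< p<n))
      (trans (toℕ-fromℕ< ph<n) (cong (_* h) (sym (toℕ-fromℕ< p<n))))
    free-W : ¬ HasZSBlock n W
    free-W = ¬HasZSBlock-triple p-prime p∣n aniso-p p∣V free-V x′ y′
      (prime⇒∤1 p-prime ∘ subst (p ∣_) (toℕ-fromℕ< 1<n))
      (trans (toℕ-fromℕ< g<n) (trans (sym (*-identityˡ g)) (cong (_* g) (sym (toℕ-fromℕ< 1<n)))))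
    |W| : length W ≡ 3 * (3 * length T + 2) + 2
    |W| = trans (length-triple V x′ y′) (cong (λ m → 3 * m + 2) (length-triple T x y))

  ¬HasZSBlock-++⁻ˡ : ∀ xs {ys} → ¬ HasZSBlock n (xs ++ ys) → ¬ HasZSBlock n xs
  ¬HasZSBlock-++⁻ˡ xs {ys} free = free ∘ HasZSBlock-infix ([] , ys , refl)

  ¬HasZSBlock-++⁻ʳ : ∀ xs {ys} → ¬ HasZSBlock n (xs ++ ys) → ¬ HasZSBlock n ys
  ¬HasZSBlock-++⁻ʳ xs {ys} free = free ∘ HasZSBlock-infix (xs , [] , cong (xs ++_) (sym (++-identityʳ ys)))

  ¬HasZSBlock⇒¬All-∣ : ∀ {p q k} → Prime p → Prime q → q ≢ p → p ∣ n → q ∣ n → 3 ≤ p → 3 ≤ q →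
    AllLengthHave n (3 * suc k) →
    ∀ T → length T ≡ k → All (p ∣ᶠ_) T → ¬ HasZSBlock n T → ¬ All (q ∣ᶠ_) T
  ¬HasZSBlock⇒¬All-∣ {k = k} p-prime q-prime q≢p p∣n q∣n 3≤p 3≤q all-len T refl p∣T free q∣T =
    let h , h<q , aniso-q = ∃-Anisotropic q-prime 3≤q
        g , g<p , aniso-p = ∃-Anisotropic p-prime 3≤p
        W , |W| , free-W = ¬HasZSBlock-amplify p-prime q-prime q≢p p∣n q∣n h<q aniso-q g<p aniso-p T p∣T q∣T free
    in free-W (AllLengthHave⇒HasZSBlock W all-len (subst (3 * suc k ≤_) (sym |W|) bound))
    where
    bound : 3 * suc k ≤ 3 * (3 * k + 2) + 2
    bound = subst (3 * suc k ≤_) (sym (spread k)) (m≤m+n (3 * suc k) (6 * k + 5))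
      where
      spread : ∀ k → 3 * (3 * k + 2) + 2 ≡ 3 * suc k + (6 * k + 5)
      spread = solve-∀

module _ {n : ℕ} (q : ℕ) where

  private
    coprime? : (x : Fin n) → Dec (¬ q ∣ᶠ x)
    coprime? x = ¬? (q ∣? toℕ x)

  coprimeCount-++ : ∀ (xs ys : List (Fin n)) → coprimeCount q (xs ++ ys) ≡ coprimeCount q xs + coprimeCount q ys
  coprimeCount-++ xs ys = trans (cong length (filter-++ coprime? xs ys)) (length-++ (filter coprime? xs))

  coprimeCount≡0 : ∀ {xs : List (Fin n)} → All (q ∣ᶠ_) xs → coprimeCount q xs ≡ 0
  coprimeCount≡0 q∣xs = cong length (filter-none coprime? (All.map (λ q∣x q∤x → q∤x q∣x) q∣xs))

  coprimeCount-[x] : ∀ {x : Fin n} → ¬ q ∣ᶠ x → coprimeCount q (x ∷ []) ≡ 1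
  coprimeCount-[x] q∤x = cong length (filter-accept coprime? q∤x)

  0<coprimeCount : ∀ {xs : List (Fin n)} → ¬ All (q ∣ᶠ_) xs → 0 < coprimeCount q xs
  0<coprimeCount {xs} ¬q∣xs = filter-some coprime? (¬All⇒Any¬ (λ x → q ∣? toℕ x) xs ¬q∣xs)

  coprimeCount-pivots : ∀ T₁ (x : Fin n) T₂ y T₃ → coprimeCount q (T₁ ++ x ∷ (T₂ ++ y ∷ T₃)) ≡
    coprimeCount q T₁ + (coprimeCount q (x ∷ []) + (coprimeCount q T₂ + (coprimeCount q (y ∷ []) + coprimeCount q T₃)))
  coprimeCount-pivots T₁ x T₂ y T₃ =
    trans (coprimeCount-++ T₁ _) (cong (coprimeCount q T₁ +_)
    (trans (coprimeCount-++ (x ∷ []) _) (cong (coprimeCount q (x ∷ []) +_)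
    (trans (coprimeCount-++ T₂ _) (cong (coprimeCount q T₂ +_) (coprimeCount-++ (y ∷ []) T₃))))))

record Pivoted {n : ℕ} (p k : ℕ) (s : List (Fin n)) : Set where
  field
    T₁ T₂ T₃ : List (Fin n)
    x y : Fin n
    s≡T₁xT₂yT₃ : s ≡ T₁ ++ x ∷ (T₂ ++ y ∷ T₃)
    |T₁|≡k : length T₁ ≡ k
    |T₂|≡k : length T₂ ≡ k
    |T₃|≡k : length T₃ ≡ k
    p∣T₁ : All (p ∣ᶠ_) T₁
    p∣T₂ : All (p ∣ᶠ_) T₂
    p∣T₃ : All (p ∣ᶠ_) T₃
    p∤x : ¬ p ∣ᶠ x
    p∤y : ¬ p ∣ᶠ y

-- the hypotheses of the theorem are these Indexed predicates on the nose, since 0 + i reduces to i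
pivoted : ∀ {n} p k (s : List (Fin n)) → 3 * suc k ≡ suc (length s) →
  Indexed (λ i z → i ≢ k → i ≢ k + suc k → p ∣ᶠ z) 0 s →
  Indexed (λ i z → i ≡ k → ¬ p ∣ᶠ z) 0 s →
  Indexed (λ i z → i ≡ k + suc k → ¬ p ∣ᶠ z) 0 s →
  Pivoted p k s
pivoted {n} p k s |s| p∣rest p∤kth p∤2kth
  with split-pivots s k (trans (sym (suc-injective |s|)) (cong (λ m → k + suc (k + suc m)) (+-identityʳ k)))
... | T₁ , x , T₂ , y , T₃ , refl , refl , |T₂| , |T₃| = record
  { T₁ = T₁ ; T₂ = T₂ ; T₃ = T₃ ; x = x ; y = y
  ; s≡T₁xT₂yT₃ = refl ; |T₁|≡k = refl ; |T₂|≡k = |T₂| ; |T₃|≡k = |T₃|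
  ; p∣T₁ = Indexed⇒All Off in-T₁ (Indexed-++ˡ Off T₁ p∣rest)
  ; p∣T₂ = Indexed⇒All Off in-T₂ (Indexed-++ˡ Off T₂ (Indexed-tail Off (Indexed-++ʳ Off T₁ p∣rest)))
  ; p∣T₃ = Indexed⇒All Off in-T₃
             (Indexed-tail Off (Indexed-++ʳ Off T₂ (Indexed-tail Off (Indexed-++ʳ Off T₁ p∣rest))))
  ; p∤x = Indexed-head At-k (Indexed-++ʳ At-k T₁ p∤kth) (+-identityʳ _)
  ; p∤y = Indexed-head At-2k+1 (Indexed-++ʳ At-2k+1 T₂ (Indexed-tail At-2k+1 (Indexed-++ʳ At-2k+1 T₁ p∤2kth)))
            (trans (+-identityʳ _) 2k+1≡)
  }
  where
  Off At-k At-2k+1 : ℕ → Fin n → Set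
  Off i z = i ≢ length T₁ → i ≢ length T₁ + suc (length T₁) → p ∣ᶠ z
  At-k i z = i ≡ length T₁ → ¬ p ∣ᶠ z
  At-2k+1 i z = i ≡ length T₁ + suc (length T₁) → ¬ p ∣ᶠ z
  2k+1≡ : suc (length T₁) + length T₂ ≡ length T₁ + suc (length T₁)
  2k+1≡ = trans (cong (suc (length T₁) +_) |T₂|) (sym (+-suc (length T₁) (length T₁)))
  in-T₁ : ∀ {i z} → 0 ≤ i → i < length T₁ → Off i z → p ∣ᶠ z
  in-T₁ _ i<k p∣z = p∣z (<⇒≢ i<k) (<⇒≢ (<-≤-trans i<k (m≤m+n _ _)))
  in-T₂ : ∀ {i z} → suc (length T₁) ≤ i → i < suc (length T₁) + length T₂ →
    Off i z → p ∣ᶠ z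
  in-T₂ {i} k<i i<2k+1 p∣z = p∣z (>⇒≢ k<i) (<⇒≢ (subst (i <_) 2k+1≡ i<2k+1))
  in-T₃ : ∀ {i z} → suc (suc (length T₁) + length T₂) ≤ i →
    i < suc (suc (length T₁) + length T₂) + length T₃ →
    Off i z → p ∣ᶠ z
  in-T₃ {i} 2k+1<i _ p∣z =
    p∣z (>⇒≢ (<-≤-trans (s≤s (m≤m+n _ _)) (<⇒≤ 2k+1<i))) (>⇒≢ (subst (_< i) 2k+1≡ 2k+1<i))

module _ {n p k} {s : List (Fin n)} (piv : Pivoted p k s) where
  open Pivoted piv

  Pivoted-coprimeCount : ∀ q → coprimeCount q s ≡ coprimeCount q T₁ + (coprimeCount q (x ∷ []) +
    (coprimeCount q T₂ + (coprimeCount q (y ∷ []) + coprimeCount q T₃)))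
  Pivoted-coprimeCount q = trans (cong (coprimeCount q) s≡T₁xT₂yT₃) (coprimeCount-pivots q T₁ x T₂ y T₃)

  Pivoted-coprimeCount≡2 : coprimeCount p s ≡ 2
  Pivoted-coprimeCount≡2 = trans (Pivoted-coprimeCount p)
    (cong₂ _+_ (coprimeCount≡0 p p∣T₁) (cong₂ _+_ (coprimeCount-[x] p p∤x)
    (cong₂ _+_ (coprimeCount≡0 p p∣T₂) (cong₂ _+_ (coprimeCount-[x] p p∤y) (coprimeCount≡0 p p∣T₃)))))

  Pivoted-3≤coprimeCount : ∀ {q} → ¬ All (q ∣ᶠ_) T₁ → ¬ All (q ∣ᶠ_) T₂ → ¬ All (q ∣ᶠ_) T₃ →
    3 ≤ coprimeCount q s
  Pivoted-3≤coprimeCount {q} ¬q∣T₁ ¬q∣T₂ ¬q∣T₃ = subst (3 ≤_) (sym (Pivoted-coprimeCount q))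
    (+-mono-≤ (0<coprimeCount q ¬q∣T₁) (+-mono-≤ (z≤n {coprimeCount q (x ∷ [])})
    (+-mono-≤ (0<coprimeCount q ¬q∣T₂) (+-mono-≤ (z≤n {coprimeCount q (y ∷ [])}) (0<coprimeCount q ¬q∣T₃)))))

  module _ .{{_ : NonZero n}} where

    Pivoted-¬HasZSBlock : ¬ HasZSBlock n s → ¬ HasZSBlock n T₁ × ¬ HasZSBlock n T₂ × ¬ HasZSBlock n T₃
    Pivoted-¬HasZSBlock s-free =
      ¬HasZSBlock-++⁻ˡ T₁ free , ¬HasZSBlock-++⁻ˡ T₂ free₂₃ ,
      ¬HasZSBlock-++⁻ʳ (y ∷ []) (¬HasZSBlock-++⁻ʳ T₂ free₂₃)
      where
      free : ¬ HasZSBlock n (T₁ ++ x ∷ (T₂ ++ y ∷ T₃))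
      free = subst (λ l → ¬ HasZSBlock n l) s≡T₁xT₂yT₃ s-free
      free₂₃ : ¬ HasZSBlock n (T₂ ++ y ∷ T₃)
      free₂₃ = ¬HasZSBlock-++⁻ʳ (x ∷ []) (¬HasZSBlock-++⁻ʳ T₁ free)

mainTheorem20 : (n : ℕ) → .{{_ : NonZero n}} → 1 < n →
    (∀ q → Prime q → q ∣ n → 7 ≤ q) →
    (s : List (Fin n)) → Extremal n s →
    (k : ℕ) → 3 * suc k ≡ suc (length s) →
    (p : ℕ) → Prime p → p ∣ n →
    (∀ (i : Fin (length s)) → toℕ i ≢ k → toℕ i ≢ k + suc k → p ∣ toℕ (lookup s i)) →
    (∀ (i : Fin (length s)) → toℕ i ≡ k → ¬ (p ∣ toℕ (lookup s i))) →
    (∀ (i : Fin (length s)) → toℕ i ≡ k + suc k → ¬ (p ∣ toℕ (lookup s i))) →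
    coprimeCount p s ≡ 2
    × (∀ q → Prime q → q ∣ n → coprimeCount q s ≡ 2 → q ≡ p)
    × (∀ q → Prime q → q ∣ n → q ≢ p → 3 ≤ coprimeCount q s)
mainTheorem20 n _ primes≥7 s ((_ , all-len , _) , s-free) k |s| p p-prime p∣n p∣rest p∤kth p∤2kth =
  Pivoted-coprimeCount≡2 piv , only-p , others
  where
  piv : Pivoted p k s
  piv = pivoted p k s |s| p∣rest p∤kth p∤2kth
  open Pivoted piv
  3≤ : ∀ {r} → Prime r → r ∣ n → 3 ≤ r
  3≤ {r} r-prime r∣n = ≤-trans (s≤s (s≤s (s≤s z≤n))) (primes≥7 r r-prime r∣n)
  others : ∀ q → Prime q → q ∣ n → q ≢ p → 3 ≤ coprimeCount q s
  others q q-prime q∣n q≢p =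
    let free₁ , free₂ , free₃ = Pivoted-¬HasZSBlock piv s-free
    in Pivoted-3≤coprimeCount piv
         (¬q∣ T₁ |T₁|≡k p∣T₁ free₁) (¬q∣ T₂ |T₂|≡k p∣T₂ free₂) (¬q∣ T₃ |T₃|≡k p∣T₃ free₃)
    where
    ¬q∣ : ∀ T → length T ≡ k → All (p ∣ᶠ_) T → ¬ HasZSBlock n T → ¬ All (q ∣ᶠ_) T
    ¬q∣ = ¬HasZSBlock⇒¬All-∣ p-prime q-prime q≢p p∣n q∣n (3≤ p-prime p∣n) (3≤ q-prime q∣n)
            (subst (AllLengthHave n) (sym |s|) all-len)
  only-p : ∀ q → Prime q → q ∣ n → coprimeCount q s ≡ 2 → q ≡ p
  only-p q q-prime q∣n count≡2 with q ≟ p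
  ... | yes q≡p = q≡p
  ... | no q≢p = contradiction (subst (3 ≤_) count≡2 (others q q-prime q∣n q≢p)) λ { (s≤s (s≤s ())) }
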